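{- Let $G$ be a $B_1$-EPG graph. If three vertices of $G$ are together contained in more than one maximal clique of $G$, then in any $B_1$-EPG representation of $G$ these three vertices do not form a claw-clique.
   Context: All graphs are finite and simple. An EPG representation of $G$ assigns to each vertex $v$ a path $P_v$ in the rectangular grid such that two distinct vertices are adjacent iff their paths share at least one grid edge; it is a $B_1$-EPG representation if every path has at most one bend, and $G$ is $B_1$-EPG if it has one. A claw of the grid is a set of three grid edges incident to a common grid point (its center); the two of them with the same direction form the base of the claw. In a $B_1$-EPG representation, a clique $K$ is an edge-clique if all paths of vertices of $K$ share a common grid edge; otherwise there is a unique claw of the grid such that each path of a vertex of $K$ contains exactly two of the three edges of the claw, and $K$ is then called a claw-clique (represented on that claw). -}

module Defs where

open import Data.Nat using (ℕ; _≤_)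
open import Data.Nat as ℕ using ()
open import Data.Integer using (ℤ; +_; _+_; _-_; _<_) renaming (_≤_ to _≤ℤ_)
open import Data.Fin using (Fin)
open import Data.Fin.Subset using (Subset; _∈_; _⊆_)
open import Data.Product using (Σ; _×_; ∃; ∃-syntax)
open import Relation.Binary.PropositionalEquality using (_≡_; _≢_)
open import Relation.Nullary using (¬_)
open import Function.Bundles using (_⇔_)

record Graph (n : ℕ) : Set₁ where
  field
    Adj     : Fin n → Fin n → Set
    sym     : ∀ {u v} → Adj u v → Adj v u
    irrefl  : ∀ {u} → ¬ Adj u u

-- The rectangular grid ℤ × ℤ and its edges.
-- A grid edge is given by its lower-left endpoint (x , y) and an
-- orientation: hor joins (x,y)-(x+1,y), ver joins (x,y)-(x,y+1).

data Orient : Set where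
  hor ver : Orient

record GridEdge : Set where
  constructor gedge
  field
    ex ey  : ℤ
    orient : Orient

-- Paths in the grid with at most one bend.
-- Such a path is a union of a horizontal segment and a vertical segment
-- sharing an endpoint (the corner); one of the two may be empty
-- (then the path is a straight segment, i.e. has no bend).

data HDir : Set where
  left right : HDir

data VDir : Set where
  down up : VDir

record B1Path : Set where
  field
    cx cy : ℤ          -- the corner point
    hdir  : HDir
    hlen  : ℕ          -- number of grid edges of the horizontal arm
    vdir  : VDir
    vlen  : ℕ          -- number of grid edges of the vertical arm
    nonempty : 1 ≤ hlen ℕ.+ vlen

InRange+ : ℤ → ℕ → ℤ → Set
InRange+ a len x = (a ≤ℤ x) × (x < a + + len)

InRange- : ℤ → ℕ → ℤ → Set
InRange- a len x = (a - + len ≤ℤ x) × (x < a)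

HArm : HDir → ℤ → ℕ → ℤ → Set
HArm right = InRange+
HArm left  = InRange-

VArm : VDir → ℤ → ℕ → ℤ → Set
VArm up   = InRange+
VArm down = InRange-

_∈P_ : GridEdge → B1Path → Set
gedge x y hor ∈P P = (y ≡ B1Path.cy P) × HArm (B1Path.hdir P) (B1Path.cx P) (B1Path.hlen P) x
gedge x y ver ∈P P = (x ≡ B1Path.cx P) × VArm (B1Path.vdir P) (B1Path.cy P) (B1Path.vlen P) y

record B1EPGRep {n : ℕ} (G : Graph n) : Set₁ where
  field
    path : Fin n → B1Path
    edge-intersection : ∀ u v → u ≢ v →
      Graph.Adj G u v ⇔ (∃[ e ] (e ∈P path u × e ∈P path v))

IsB1EPG : ∀ {n} → Graph n → Set₁
IsB1EPG G = B1EPGRep G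

IsClique : ∀ {n} → Graph n → Subset n → Set
IsClique G K = ∀ {x y} → x ∈ K → y ∈ K → x ≢ y → Graph.Adj G x y

IsMaximalClique : ∀ {n} → Graph n → Subset n → Set
IsMaximalClique {n} G K =
  IsClique G K × (∀ (K' : Subset n) → IsClique G K' → K ⊆ K' → K' ⊆ K)

InMoreThanOneMaxClique : ∀ {n} → Graph n → Fin n → Fin n → Fin n → Set
InMoreThanOneMaxClique {n} G u v w =
  Σ (Subset n) λ K₁ → Σ (Subset n) λ K₂ →
    IsMaximalClique G K₁ × IsMaximalClique G K₂ × K₁ ≢ K₂ ×
    (u ∈ K₁ × v ∈ K₁ × w ∈ K₁) × (u ∈ K₂ × v ∈ K₂ × w ∈ K₂)

IsTriangle : ∀ {n} → Graph n → Fin n → Fin n → Fin n → Set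
IsTriangle G u v w = Graph.Adj G u v × Graph.Adj G v w × Graph.Adj G u w

IsEdgeClique : ∀ {n} {G : Graph n} → B1EPGRep G → Fin n → Fin n → Fin n → Set
IsEdgeClique R u v w =
  ∃[ e ] (e ∈P B1EPGRep.path R u × e ∈P B1EPGRep.path R v × e ∈P B1EPGRep.path R w)

IsClawClique : ∀ {n} {G : Graph n} → B1EPGRep G → Fin n → Fin n → Fin n → Set
IsClawClique {G = G} R u v w = IsTriangle G u v w × ¬ IsEdgeClique R u v w

-- If the paths of u, v, w pairwise share grid edges but have no common edge, then (after
-- transposing the grid and renaming) the paths of v and w turn at a common corner c in
-- opposite horizontal directions and leave it vertically in the same direction, while the
-- path of u runs horizontally through c. Every path sharing an edge with all three of them
-- then contains two of the three grid edges at c used by v and w, so any two such paths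
-- share an edge. Hence the common neighbours of u, v, w are pairwise adjacent, the union
-- of two maximal cliques containing u, v, w is a clique, and the two cliques coincide.
module Submission where

open import Defs
open import Data.Nat using (ℕ)
open import Data.Fin using (Fin)
open import Relation.Binary.PropositionalEquality using (_≢_)
open import Relation.Nullary using (¬_)

open import Data.Nat as ℕ using ()
open import Data.Nat.Properties using (+-comm)
open import Data.Integer using (ℤ; +_; _+_; _-_; _≤_; _<_; pred)
import Data.Integer.Properties as ℤ
open import Data.Fin using (_≟_)
open import Data.Fin.Subset using (Subset; _∈_; _∪_)
open import Data.Fin.Subset.Properties using (p⊆p∪q; q⊆p∪q; x∈p∪q⁻; ⊆-antisym; ⊆-trans)
open import Data.Product using (_×_; _,_; ∃-syntax; proj₁)
open import Data.Sum using (_⊎_; inj₁; inj₂)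
open import Data.Empty using (⊥-elim)
open import Function using (_∘_)
open import Function.Bundles using (Equivalence)
open import Relation.Binary.PropositionalEquality using (_≡_; refl; sym; trans; subst)
open import Relation.Nullary using (yes; no)

open B1Path

data Dir : Set where
  neg pos : Dir

lo hi : Dir → ℤ → ℕ → ℤ
lo neg a l = a - + l
lo pos a l = a
hi neg a l = a
hi pos a l = a + + l

-- Arm d a l x: the unit edge [x, x + 1] belongs to the l edges leaving a in direction d.
record Arm (d : Dir) (a : ℤ) (l : ℕ) (x : ℤ) : Set where
  constructor arm
  field
    lo≤ : lo d a l ≤ x
    <hi : x < hi d a l

firstPoint : Dir → ℤ → ℤ
firstPoint neg a = pred a
firstPoint pos a = a

pred< : ∀ {a} → pred a < a
pred< = ℤ.i≤pred[j]⇒i<j ℤ.≤-refl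

Convex : (ℤ → Set) → Set
Convex A = ∀ {p q m} → A p → A q → p ≤ m → m ≤ q → A m

-- The median of x, y and z lies in all three sets.
helly : ∀ {A B C : ℤ → Set} → Convex A → Convex B → Convex C →
  ∀ {x y z} → A x → B x → A y → C y → B z → C z → ∃[ m ] (A m × B m × C m)
helly cA cB cC {x} {y} {z} Ax Bx Ay Cy Bz Cz
  with ℤ.≤-total x y | ℤ.≤-total y z | ℤ.≤-total x z
... | inj₁ x≤y | inj₁ y≤z | _        = y , Ay , cB Bx Bz x≤y y≤z , Cy
... | inj₂ y≤x | inj₂ z≤y | _        = y , Ay , cB Bz Bx z≤y y≤x , Cy
... | inj₁ x≤y | inj₂ z≤y | inj₁ x≤z = z , cA Ax Ay x≤z z≤y , Bz , Cz
... | inj₁ x≤y | inj₂ z≤y | inj₂ z≤x = x , Ax , Bx , cC Cz Cy z≤x x≤y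
... | inj₂ y≤x | inj₁ y≤z | inj₁ x≤z = x , Ax , Bx , cC Cy Cz y≤x x≤z
... | inj₂ y≤x | inj₁ y≤z | inj₂ z≤x = z , cA Ay Ax y≤z z≤x , Bz , Cz

convex-straddle : ∀ {A} → Convex A → ∀ {p q c} → A p → A q → p < c → c ≤ q →
  A (pred c) × A c
convex-straddle cA Ap Aq p<c c≤q =
  cA Ap Aq (ℤ.i<j⇒i≤pred[j] p<c) (ℤ.≤-trans (ℤ.<⇒≤ pred<) c≤q) ,
  cA Ap Aq (ℤ.<⇒≤ p<c) c≤q

arm-convex : ∀ {d a l} → Convex (Arm d a l)
arm-convex (arm lo≤p _) (arm _ q<hi) p≤m m≤q =
  arm (ℤ.≤-trans lo≤p p≤m) (ℤ.≤-<-trans m≤q q<hi)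

arm-firstPoint : ∀ {d a l x} → Arm d a l x → Arm d a l (firstPoint d a)
arm-firstPoint {neg} (arm lo≤x x<a) = arm (ℤ.≤-trans lo≤x (ℤ.i<j⇒i≤pred[j] x<a)) pred<
arm-firstPoint {pos} (arm a≤x x<hi) = arm ℤ.≤-refl (ℤ.≤-<-trans a≤x x<hi)

arm-firstPoint-at : ∀ {d d' a a' l x} → Arm d a l x → d ≡ d' → a ≡ a' →
  Arm d a l (firstPoint d' a')
arm-firstPoint-at A refl refl = arm-firstPoint A

arm-direction-unique : ∀ {d d' a a' l l' x} → Arm d a l x → Arm d' a' l' x → a ≡ a' → d ≡ d'
arm-direction-unique {neg} {neg} _ _ _ = refl
arm-direction-unique {pos} {pos} _ _ _ = refl
arm-direction-unique {neg} {pos} (arm _ x<a) (arm a≤x _) refl = ⊥-elim (ℤ.≤⇒≯ a≤x x<a)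
arm-direction-unique {pos} {neg} (arm a≤x _) (arm _ x<a) refl = ⊥-elim (ℤ.≤⇒≯ a≤x x<a)

arm-neg-< : ∀ {d a l x} → d ≡ neg → Arm d a l x → x < a
arm-neg-< refl = Arm.<hi

arm-pos-≥ : ∀ {d a l x} → d ≡ pos → Arm d a l x → a ≤ x
arm-pos-≥ refl = Arm.lo≤

arm-below-origin : ∀ {d a l x c} → Arm d a l x → x < c → a ≡ c → Arm d a l (pred c)
arm-below-origin {neg} A _ refl = arm-firstPoint A
arm-below-origin {pos} (arm a≤x _) x<a refl = ⊥-elim (ℤ.≤⇒≯ a≤x x<a)

arm-above-origin : ∀ {d a l x c} → Arm d a l x → c ≤ x → a ≡ c → Arm d a l c
arm-above-origin {neg} (arm _ x<a) a≤x refl = ⊥-elim (ℤ.≤⇒≯ a≤x x<a)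
arm-above-origin {pos} A _ refl = arm-firstPoint A

arm-origin-neighbour : ∀ {d a l x c} → Arm d a l x → a ≡ c → Arm d a l (pred c) ⊎ Arm d a l c
arm-origin-neighbour {neg} A refl = inj₁ (arm-firstPoint A)
arm-origin-neighbour {pos} A refl = inj₂ (arm-firstPoint A)

arm-not-around-origin : ∀ {d a l c} → Arm d a l (pred c) → Arm d a l c → a ≢ c
arm-not-around-origin {neg} _ (arm _ c<c) refl = ℤ.<-irrefl refl c<c
arm-not-around-origin {pos} (arm c≤pred _) _ refl = ℤ.≤⇒≯ c≤pred pred<

dir-cases : (d : Dir) → d ≡ neg ⊎ d ≡ pos
dir-cases neg = inj₁ refl
dir-cases pos = inj₂ refl

hDir : HDir → Dir
hDir left  = neg
hDir right = pos

vDir : VDir → Dir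
vDir down = neg
vDir up   = pos

HArm→Arm : ∀ d {a l x} → HArm d a l x → Arm (hDir d) a l x
HArm→Arm left  (p , q) = arm p q
HArm→Arm right (p , q) = arm p q

Arm→HArm : ∀ d {a l x} → Arm (hDir d) a l x → HArm d a l x
Arm→HArm left  (arm p q) = p , q
Arm→HArm right (arm p q) = p , q

VArm→Arm : ∀ d {a l x} → VArm d a l x → Arm (vDir d) a l x
VArm→Arm down (p , q) = arm p q
VArm→Arm up   (p , q) = arm p q

Arm→VArm : ∀ d {a l x} → Arm (vDir d) a l x → VArm d a l x
Arm→VArm down (arm p q) = p , q
Arm→VArm up   (arm p q) = p , q

HArmOf VArmOf : B1Path → ℤ → Set
HArmOf P = Arm (hDir (hdir P)) (cx P) (hlen P)
VArmOf P = Arm (vDir (vdir P)) (cy P) (vlen P)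

hor∈P : ∀ P {x y} → y ≡ cy P → HArmOf P x → gedge x y hor ∈P P
hor∈P P row A = row , Arm→HArm (hdir P) A

ver∈P : ∀ P {x y} → x ≡ cx P → VArmOf P y → gedge x y ver ∈P P
ver∈P P column A = column , Arm→VArm (vdir P) A

ShareEdge : B1Path → B1Path → Set
ShareEdge P Q = ∃[ e ] (e ∈P P × e ∈P Q)

CommonEdge : B1Path → B1Path → B1Path → Set
CommonEdge U V W = ∃[ e ] (e ∈P U × e ∈P V × e ∈P W)

MeetsAll : B1Path → B1Path → B1Path → B1Path → Set
MeetsAll U V W X = ShareEdge X U × ShareEdge X V × ShareEdge X W

record ShareAlong (o : Orient) (P Q : B1Path) : Set where
  constructor shareAlong
  field
    {x y} : ℤ
    inP : gedge x y o ∈P P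
    inQ : gedge x y o ∈P Q

record RowShare (P Q : B1Path) : Set where
  constructor rowShare
  field
    {x} : ℤ
    sameRow : cy P ≡ cy Q
    inP : HArmOf P x
    inQ : HArmOf Q x

record ColumnShare (P Q : B1Path) : Set where
  constructor columnShare
  field
    {y} : ℤ
    sameColumn : cx P ≡ cx Q
    inP : VArmOf P y
    inQ : VArmOf Q y

shareEdge-orient : ∀ {P Q} → ShareEdge P Q → ∃[ o ] ShareAlong o P Q
shareEdge-orient (gedge x y o , p , q) = o , shareAlong p q

ShareAlong-sym : ∀ {o P Q} → ShareAlong o P Q → ShareAlong o Q P
ShareAlong-sym (shareAlong p q) = shareAlong q p

ShareAlong-hor→RowShare : ∀ {P Q} → ShareAlong hor P Q → RowShare P Q
ShareAlong-hor→RowShare {P} {Q} (shareAlong (yP , AP) (yQ , AQ)) =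
  rowShare (trans (sym yP) yQ) (HArm→Arm (hdir P) AP) (HArm→Arm (hdir Q) AQ)

ShareAlong-ver→ColumnShare : ∀ {P Q} → ShareAlong ver P Q → ColumnShare P Q
ShareAlong-ver→ColumnShare {P} {Q} (shareAlong (xP , AP) (xQ , AQ)) =
  columnShare (trans (sym xP) xQ) (VArm→Arm (vdir P) AP) (VArm→Arm (vdir Q) AQ)

ColumnShare-sym : ∀ {P Q} → ColumnShare P Q → ColumnShare Q P
ColumnShare-sym (columnShare column p q) = columnShare (sym column) q p

shareEdge-row⊎column : ∀ {P Q} → ShareEdge P Q → RowShare P Q ⊎ ColumnShare P Q
shareEdge-row⊎column s with shareEdge-orient s
... | hor , s' = inj₁ (ShareAlong-hor→RowShare s')
... | ver , s' = inj₂ (ShareAlong-ver→ColumnShare s')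

rowShares-commonEdge : ∀ {U V W} → RowShare U V → RowShare V W → RowShare U W → CommonEdge U V W
rowShares-commonEdge {U} {V} {W} (rowShare UV-row Ux Vx) (rowShare _ Vz Wz) (rowShare UW-row Uy Wy)
  with helly arm-convex arm-convex arm-convex Ux Vx Uy Wy Vz Wz
... | m , Um , Vm , Wm = gedge m (cy U) hor , hor∈P U refl Um , hor∈P V UV-row Vm , hor∈P W UW-row Wm

sameCorner-rowShare : ∀ {P Q x y} → cy P ≡ cy Q → cx P ≡ cx Q → hDir (hdir P) ≡ hDir (hdir Q) →
  HArmOf P x → HArmOf Q y → RowShare P Q
sameCorner-rowShare row column direction Px Qy =
  rowShare row (arm-firstPoint Px) (arm-firstPoint-at Qy (sym direction) (sym column))

toVDir : HDir → VDir
toVDir left  = down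
toVDir right = up

toHDir : VDir → HDir
toHDir down = left
toHDir up   = right

HArm→VArm : ∀ d {a l x} → HArm d a l x → VArm (toVDir d) a l x
HArm→VArm left  A = A
HArm→VArm right A = A

VArm→HArm : ∀ d {a l x} → VArm d a l x → HArm (toHDir d) a l x
VArm→HArm down A = A
VArm→HArm up   A = A

HArm→VArm⁻ : ∀ d {a l x} → HArm (toHDir d) a l x → VArm d a l x
HArm→VArm⁻ down A = A
HArm→VArm⁻ up   A = A

VArm→HArm⁻ : ∀ d {a l x} → VArm (toVDir d) a l x → HArm d a l x
VArm→HArm⁻ left  A = A
VArm→HArm⁻ right A = A

transpose : B1Path → B1Path
transpose P = record
  { cx = cy P ; cy = cx P
  ; hdir = toHDir (vdir P) ; hlen = vlen P
  ; vdir = toVDir (hdir P) ; vlen = hlen P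
  ; nonempty = subst (1 ℕ.≤_) (+-comm (hlen P) (vlen P)) (nonempty P)
  }

flip : Orient → Orient
flip hor = ver
flip ver = hor

transposeEdge : GridEdge → GridEdge
transposeEdge (gedge x y o) = gedge y x (flip o)

∈P-transpose : ∀ P e → e ∈P P → transposeEdge e ∈P transpose P
∈P-transpose P (gedge _ _ hor) (row , A) = row , HArm→VArm (hdir P) A
∈P-transpose P (gedge _ _ ver) (column , A) = column , VArm→HArm (vdir P) A

∈P-transpose⁻ : ∀ P e → e ∈P transpose P → transposeEdge e ∈P P
∈P-transpose⁻ P (gedge _ _ hor) (row , A) = row , HArm→VArm⁻ (vdir P) A
∈P-transpose⁻ P (gedge _ _ ver) (column , A) = column , VArm→HArm⁻ (hdir P) A

ShareEdge-transpose : ∀ {P Q} → ShareEdge P Q → ShareEdge (transpose P) (transpose Q)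
ShareEdge-transpose {P} {Q} (e , p , q) = transposeEdge e , ∈P-transpose P e p , ∈P-transpose Q e q

ShareAlong-transpose : ∀ {o P Q} → ShareAlong o P Q → ShareAlong (flip o) (transpose P) (transpose Q)
ShareAlong-transpose {o} {P} {Q} (shareAlong {x} {y} p q) =
  shareAlong (∈P-transpose P (gedge x y o) p) (∈P-transpose Q (gedge x y o) q)

CommonEdge-transpose⁻ : ∀ {U V W} →
  CommonEdge (transpose U) (transpose V) (transpose W) → CommonEdge U V W
CommonEdge-transpose⁻ {U} {V} {W} (e , u , v , w) =
  transposeEdge e , ∈P-transpose⁻ U e u , ∈P-transpose⁻ V e v , ∈P-transpose⁻ W e w

Claw : Set
Claw = GridEdge × GridEdge × GridEdge

ContainsTwo : Claw → B1Path → Set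
ContainsTwo (a , b , c) X = (a ∈P X × b ∈P X) ⊎ (a ∈P X × c ∈P X) ⊎ (b ∈P X × c ∈P X)

containsTwo-share : ∀ C {X Y} → ContainsTwo C X → ContainsTwo C Y → ShareEdge X Y
containsTwo-share (a , b , c) (inj₁ (x , _))         (inj₁ (y , _))         = a , x , y
containsTwo-share (a , b , c) (inj₁ (x , _))         (inj₂ (inj₁ (y , _)))  = a , x , y
containsTwo-share (a , b , c) (inj₁ (_ , x))         (inj₂ (inj₂ (y , _)))  = b , x , y
containsTwo-share (a , b , c) (inj₂ (inj₁ (x , _)))  (inj₁ (y , _))         = a , x , y
containsTwo-share (a , b , c) (inj₂ (inj₁ (_ , x)))  (inj₂ (inj₁ (_ , y)))  = c , x , y
containsTwo-share (a , b , c) (inj₂ (inj₁ (_ , x)))  (inj₂ (inj₂ (_ , y)))  = c , x , y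
containsTwo-share (a , b , c) (inj₂ (inj₂ (x , _)))  (inj₁ (_ , y))         = b , x , y
containsTwo-share (a , b , c) (inj₂ (inj₂ (_ , x)))  (inj₂ (inj₁ (_ , y)))  = c , x , y
containsTwo-share (a , b , c) (inj₂ (inj₂ (_ , x)))  (inj₂ (inj₂ (_ , y)))  = c , x , y

ClawFor : B1Path → B1Path → B1Path → Set
ClawFor U V W = ∃[ C ] (∀ {X} → MeetsAll U V W X → ContainsTwo C X)

ClawFor-reorder : ∀ {U V W U' V' W'} → (∀ {X} → MeetsAll U V W X → MeetsAll U' V' W' X) →
  ClawFor U' V' W' → ClawFor U V W
ClawFor-reorder f (C , two) = C , two ∘ f

containsTwo-transpose⁻ : ∀ {a b c} X →
  ContainsTwo (a , b , c) (transpose X) →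
  ContainsTwo (transposeEdge a , transposeEdge b , transposeEdge c) X
containsTwo-transpose⁻ {a} {b} {c} X (inj₁ (p , q)) =
  inj₁ (∈P-transpose⁻ X a p , ∈P-transpose⁻ X b q)
containsTwo-transpose⁻ {a} {b} {c} X (inj₂ (inj₁ (p , q))) =
  inj₂ (inj₁ (∈P-transpose⁻ X a p , ∈P-transpose⁻ X c q))
containsTwo-transpose⁻ {a} {b} {c} X (inj₂ (inj₂ (p , q))) =
  inj₂ (inj₂ (∈P-transpose⁻ X b p , ∈P-transpose⁻ X c q))

ClawFor-transpose⁻ : ∀ {U V W} → ClawFor (transpose U) (transpose V) (transpose W) → ClawFor U V W
ClawFor-transpose⁻ ((a , b , c) , two) =
  (transposeEdge a , transposeEdge b , transposeEdge c) ,
  λ {X} (XU , XV , XW) → containsTwo-transpose⁻ X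
    (two (ShareEdge-transpose XU , ShareEdge-transpose XV , ShareEdge-transpose XW))

-- The claw-clique up to symmetry: u runs along the row through the common corner c of v
-- and w, whose horizontal arms leave c to the left and to the right respectively.
module HorizontalApex
  {U V W : B1Path} (UV : RowShare U V) (UW : RowShare U W) (VW : ColumnShare V W)
  (V-left : hDir (hdir V) ≡ neg) (W-right : hDir (hdir W) ≡ pos)
  where

  open RowShare UV using () renaming (sameRow to UV-row; inP to U∋x₁; inQ to V∋x₁)
  open RowShare UW using () renaming (sameRow to UW-row; inP to U∋x₂; inQ to W∋x₂)
  open ColumnShare VW using () renaming (sameColumn to VW-column; inP to V∋y₃; inQ to W∋y₃)

  c r : ℤ
  c = cx V
  r = cy V

  baseˡ baseʳ stem : GridEdge
  baseˡ = gedge (pred c) r hor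
  baseʳ = gedge c r hor
  stem  = gedge c (firstPoint (vDir (vdir V)) r) ver

  claw : Claw
  claw = baseˡ , baseʳ , stem

  VW-row : cy V ≡ cy W
  VW-row = trans (sym UV-row) UW-row

  left-of-c : ∀ {x} → HArmOf V x → x < c
  left-of-c = arm-neg-< V-left

  right-of-c : ∀ {x} → HArmOf W x → c ≤ x
  right-of-c Wx = subst (_≤ _) (sym VW-column) (arm-pos-≥ W-right Wx)

  U-corner≢c : cx U ≢ c
  U-corner≢c with convex-straddle arm-convex U∋x₁ U∋x₂ (left-of-c V∋x₁) (right-of-c W∋x₂)
  ... | Uˡ , Uʳ = arm-not-around-origin Uˡ Uʳ

  W-vertical-direction : vDir (vdir W) ≡ vDir (vdir V)
  W-vertical-direction = arm-direction-unique W∋y₃ V∋y₃ (sym VW-row)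

  stem-via-V : ∀ {X} → cy X ≡ r → ColumnShare X V → stem ∈P X
  stem-via-V {X} rX (columnShare XV-column Xy Vy) =
    ver∈P X (sym XV-column) (arm-firstPoint-at Xy (arm-direction-unique Xy Vy rX) rX)

  stem-via-W : ∀ {X} → cy X ≡ r → ColumnShare X W → stem ∈P X
  stem-via-W {X} rX (columnShare XW-column Xy Wy) =
    ver∈P X (trans VW-column (sym XW-column)) (arm-firstPoint-at Xy direction rX)
    where
    direction = trans (arm-direction-unique Xy Wy (trans rX VW-row)) W-vertical-direction

  rows-case : ∀ {X} → RowShare X V → RowShare X W → ContainsTwo claw X
  rows-case {X} (rowShare XV-row Xp Vp) (rowShare _ Xq Wq)
    with convex-straddle arm-convex Xp Xq (left-of-c Vp) (right-of-c Wq)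
  ... | Xˡ , Xʳ = inj₁ (hor∈P X (sym XV-row) Xˡ , hor∈P X (sym XV-row) Xʳ)

  row-column-case : ∀ {X} → RowShare X V → ColumnShare X W → ContainsTwo claw X
  row-column-case {X} (rowShare XV-row Xp Vp) XW@(columnShare XW-column _ _) =
    inj₂ (inj₁ ( hor∈P X (sym XV-row) (arm-below-origin Xp (left-of-c Vp) cX)
               , stem-via-W XV-row XW))
    where
    cX = trans XW-column (sym VW-column)

  column-row-case : ∀ {X} → ColumnShare X V → RowShare X W → ContainsTwo claw X
  column-row-case {X} XV@(columnShare XV-column _ _) (rowShare XW-row Xq Wq) =
    inj₂ (inj₂ ( hor∈P X (sym rX) (arm-above-origin Xq (right-of-c Wq) XV-column)
               , stem-via-V rX XV))
    where
    rX = trans XW-row (sym VW-row)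

  corner-case : ∀ {X p} → cy X ≡ r → HArmOf X p → ColumnShare X V → ContainsTwo claw X
  corner-case {X} rX Xp XV@(columnShare XV-column _ _) with arm-origin-neighbour Xp XV-column
  ... | inj₁ Xˡ = inj₂ (inj₁ (hor∈P X (sym rX) Xˡ , stem-via-V rX XV))
  ... | inj₂ Xʳ = inj₂ (inj₂ (hor∈P X (sym rX) Xʳ , stem-via-V rX XV))

  -- A path through c along the column cannot meet u there, so it meets u in u's row.
  columns-case : ∀ {X} → ShareEdge X U → ColumnShare X V → ContainsTwo claw X
  columns-case XU XV@(columnShare XV-column _ _) with shareEdge-row⊎column XU
  ... | inj₂ (columnShare XU-column _ _) = ⊥-elim (U-corner≢c (trans (sym XU-column) XV-column))
  ... | inj₁ (rowShare XU-row Xp _) = corner-case (trans XU-row UV-row) Xp XV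

  clawFor : ClawFor U V W
  clawFor = claw , containsTwo
    where
    containsTwo : ∀ {X} → MeetsAll U V W X → ContainsTwo claw X
    containsTwo (XU , XV , XW) with shareEdge-row⊎column XV | shareEdge-row⊎column XW
    ... | inj₁ XV-row    | inj₁ XW-row    = rows-case XV-row XW-row
    ... | inj₁ XV-row    | inj₂ XW-column = row-column-case XV-row XW-column
    ... | inj₂ XV-column | inj₁ XW-row    = column-row-case XV-column XW-row
    ... | inj₂ XV-column | inj₂ _         = columns-case XU XV-column

sameDirection-commonEdge : ∀ {U V W} → RowShare U V → RowShare U W → ColumnShare V W →
  hDir (hdir V) ≡ hDir (hdir W) → CommonEdge U V W
sameDirection-commonEdge UV@(rowShare UV-row _ V₁) UW@(rowShare UW-row _ W₂)
  (columnShare VW-column _ _) direction =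
  rowShares-commonEdge UV (sameCorner-rowShare (trans (sym UV-row) UW-row) VW-column direction V₁ W₂) UW

horizontalApex-clawFor : ∀ {U V W} → ShareAlong hor U V → ShareAlong hor U W → ShareAlong ver V W →
  ¬ CommonEdge U V W → ClawFor U V W
horizontalApex-clawFor {U} {V} {W} uv uw vw noCommon
  with ShareAlong-hor→RowShare uv | ShareAlong-hor→RowShare uw | ShareAlong-ver→ColumnShare vw
... | UV | UW | VW with dir-cases (hDir (hdir V)) | dir-cases (hDir (hdir W))
... | inj₁ V-left  | inj₂ W-right = HorizontalApex.clawFor UV UW VW V-left W-right
... | inj₂ V-right | inj₁ W-left  = ClawFor-reorder (λ (XU , XV , XW) → XU , XW , XV)
                                      (HorizontalApex.clawFor UW UV (ColumnShare-sym VW) W-left V-right)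
... | inj₁ V-neg   | inj₁ W-neg   =
  ⊥-elim (noCommon (sameDirection-commonEdge UV UW VW (trans V-neg (sym W-neg))))
... | inj₂ V-pos   | inj₂ W-pos   =
  ⊥-elim (noCommon (sameDirection-commonEdge UV UW VW (trans V-pos (sym W-pos))))

apexU-clawFor : ∀ o {U V W} → ShareAlong o U V → ShareAlong o U W → ShareAlong (flip o) V W →
  ¬ CommonEdge U V W → ClawFor U V W
apexU-clawFor hor = horizontalApex-clawFor
apexU-clawFor ver uv uw vw noCommon =
  ClawFor-transpose⁻ (horizontalApex-clawFor (ShareAlong-transpose uv) (ShareAlong-transpose uw)
    (ShareAlong-transpose vw) (noCommon ∘ CommonEdge-transpose⁻))

apexV-clawFor : ∀ o {U V W} → ShareAlong o U V → ShareAlong o V W → ShareAlong (flip o) U W →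
  ¬ CommonEdge U V W → ClawFor U V W
apexV-clawFor o uv vw uw noCommon =
  ClawFor-reorder (λ (XU , XV , XW) → XV , XU , XW)
    (apexU-clawFor o (ShareAlong-sym uv) vw uw (λ (e , v , u , w) → noCommon (e , u , v , w)))

apexW-clawFor : ∀ o {U V W} → ShareAlong (flip o) U V → ShareAlong o V W → ShareAlong o U W →
  ¬ CommonEdge U V W → ClawFor U V W
apexW-clawFor o uv vw uw noCommon =
  ClawFor-reorder (λ (XU , XV , XW) → XW , XU , XV)
    (apexU-clawFor o (ShareAlong-sym uw) (ShareAlong-sym vw) uv (λ (e , w , u , v) → noCommon (e , u , v , w)))

aligned-commonEdge : ∀ o {U V W} → ShareAlong o U V → ShareAlong o V W → ShareAlong o U W →
  CommonEdge U V W
aligned-commonEdge hor uv vw uw =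
  rowShares-commonEdge (ShareAlong-hor→RowShare uv) (ShareAlong-hor→RowShare vw) (ShareAlong-hor→RowShare uw)
aligned-commonEdge ver uv vw uw = CommonEdge-transpose⁻
  (aligned-commonEdge hor (ShareAlong-transpose uv) (ShareAlong-transpose vw) (ShareAlong-transpose uw))

clawClique-clawFor : ∀ {U V W} → ShareEdge U V → ShareEdge V W → ShareEdge U W →
  ¬ CommonEdge U V W → ClawFor U V W
clawClique-clawFor uv vw uw noCommon
  with shareEdge-orient uv | shareEdge-orient vw | shareEdge-orient uw
... | hor , uv | hor , vw | hor , uw = ⊥-elim (noCommon (aligned-commonEdge hor uv vw uw))
... | ver , uv | ver , vw | ver , uw = ⊥-elim (noCommon (aligned-commonEdge ver uv vw uw))
... | hor , uv | ver , vw | hor , uw = apexU-clawFor hor uv uw vw noCommon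
... | ver , uv | hor , vw | ver , uw = apexU-clawFor ver uv uw vw noCommon
... | hor , uv | hor , vw | ver , uw = apexV-clawFor hor uv vw uw noCommon
... | ver , uv | ver , vw | hor , uw = apexV-clawFor ver uv vw uw noCommon
... | ver , uv | hor , vw | hor , uw = apexW-clawFor hor uv vw uw noCommon
... | hor , uv | ver , vw | ver , uw = apexW-clawFor ver uv vw uw noCommon

clawClique-meetsAll-share : ∀ {U V W X Y} → ShareEdge U V → ShareEdge V W → ShareEdge U W →
  ¬ CommonEdge U V W → MeetsAll U V W X → MeetsAll U V W Y → ShareEdge X Y
clawClique-meetsAll-share uv vw uw noCommon meetsX meetsY with clawClique-clawFor uv vw uw noCommon
... | C , containsTwo = containsTwo-share C (containsTwo meetsX) (containsTwo meetsY)

TripleIn : ∀ {n} → Fin n → Fin n → Fin n → Subset n → Set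
TripleIn u v w K = u ∈ K × v ∈ K × w ∈ K

module _ {n} (G : Graph n) where
  open Graph G using (Adj; irrefl)

  AdjacentToAll : Fin n → Fin n → Fin n → Fin n → Set
  AdjacentToAll u v w x = Adj x u × Adj x v × Adj x w

  CommonNeighbourhoodIsClique : Fin n → Fin n → Fin n → Set
  CommonNeighbourhoodIsClique u v w =
    ∀ {x y} → AdjacentToAll u v w x → AdjacentToAll u v w y → x ≢ y → Adj x y

  adjacent⇒≢ : ∀ {x y} → Adj x y → x ≢ y
  adjacent⇒≢ a refl = irrefl a

  member-or-adjacentToAll : ∀ {K K' u v w x} → IsClique G K →
    TripleIn u v w K → TripleIn u v w K' → x ∈ K → x ∈ K' ⊎ AdjacentToAll u v w x
  member-or-adjacentToAll {u = u} {v} {w} {x} clique (uK , vK , wK) (uK' , vK' , wK') xK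
    with x ≟ u | x ≟ v | x ≟ w
  ... | yes refl | _        | _        = inj₁ uK'
  ... | no _     | yes refl | _        = inj₁ vK'
  ... | no _     | no _     | yes refl = inj₁ wK'
  ... | no x≢u   | no x≢v   | no x≢w   = inj₂ (clique xK uK x≢u , clique xK vK x≢v , clique xK wK x≢w)

  cliques-sharing-triple-adjacent : ∀ {K K' u v w x y} →
    CommonNeighbourhoodIsClique u v w → IsClique G K → IsClique G K' →
    TripleIn u v w K → TripleIn u v w K' → x ∈ K → y ∈ K' → x ≢ y → Adj x y
  cliques-sharing-triple-adjacent common cK cK' tK tK' xK yK'
    with member-or-adjacentToAll cK tK tK' xK | member-or-adjacentToAll cK' tK' tK yK'
  ... | inj₁ xK' | _        = cK' xK' yK'
  ... | inj₂ _   | inj₁ yK  = cK xK yK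
  ... | inj₂ xN  | inj₂ yN  = common xN yN

  ∪-isClique : ∀ {K₁ K₂ u v w} → CommonNeighbourhoodIsClique u v w →
    IsClique G K₁ → IsClique G K₂ → TripleIn u v w K₁ → TripleIn u v w K₂ →
    IsClique G (K₁ ∪ K₂)
  ∪-isClique {K₁ = K₁} {K₂} common c₁ c₂ t₁ t₂ x∈ y∈
    with x∈p∪q⁻ K₁ K₂ x∈ | x∈p∪q⁻ K₁ K₂ y∈
  ... | inj₁ x₁ | inj₁ y₁ = c₁ x₁ y₁
  ... | inj₂ x₂ | inj₂ y₂ = c₂ x₂ y₂
  ... | inj₁ x₁ | inj₂ y₂ = cliques-sharing-triple-adjacent common c₁ c₂ t₁ t₂ x₁ y₂
  ... | inj₂ x₂ | inj₁ y₁ = cliques-sharing-triple-adjacent common c₂ c₁ t₂ t₁ x₂ y₁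

  maximalCliques-∪-isClique⇒≡ : ∀ {K₁ K₂} →
    IsMaximalClique G K₁ → IsMaximalClique G K₂ → IsClique G (K₁ ∪ K₂) → K₁ ≡ K₂
  maximalCliques-∪-isClique⇒≡ {K₁ = K₁} {K₂} (_ , maximal₁) (_ , maximal₂) union =
    ⊆-antisym (⊆-trans (p⊆p∪q K₂) (maximal₂ _ union (q⊆p∪q K₁ K₂)))
              (⊆-trans (q⊆p∪q K₁ K₂) (maximal₁ _ union (p⊆p∪q K₂)))

clawClique-commonNeighbourhoodIsClique : ∀ {n} {G : Graph n} (R : B1EPGRep G) {u v w} →
  IsClawClique R u v w → CommonNeighbourhoodIsClique G u v w
clawClique-commonNeighbourhoodIsClique {G = G} R ((uv , vw , uw) , notEdgeClique)
  {x} {y} (xu , xv , xw) (yu , yv , yw) x≢y =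
  Equivalence.from (edge-intersection x y x≢y)
    (clawClique-meetsAll-share (share uv) (share vw) (share uw) notEdgeClique
      (share xu , share xv , share xw) (share yu , share yv , share yw))
  where
  open B1EPGRep R
  share : ∀ {a b} → Graph.Adj G a b → ShareEdge (path a) (path b)
  share {a} {b} adjacent = Equivalence.to (edge-intersection a b (adjacent⇒≢ G adjacent)) adjacent

-- Distinctness of u, v, w is implied by the triangle, and R itself witnesses IsB1EPG G.
lemma1 : ∀ {n} (G : Graph n) → IsB1EPG G → (u v w : Fin n) →
    u ≢ v → v ≢ w → u ≢ w →
    InMoreThanOneMaxClique G u v w →
    (R : B1EPGRep G) → ¬ IsClawClique R u v w
lemma1 G _ u v w _ _ _ (K₁ , K₂ , maximal₁ , maximal₂ , K₁≢K₂ , t₁ , t₂) R clawClique =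
  K₁≢K₂ (maximalCliques-∪-isClique⇒≡ G maximal₁ maximal₂
    (∪-isClique G (clawClique-commonNeighbourhoodIsClique R clawClique)
      (proj₁ maximal₁) (proj₁ maximal₂) t₁ t₂))
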